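{- Let $G$ be a graph with $\Delta(G)\le 4$ and $n(G)\ge 7$. Then ${\rm mdim}(G)\le n(G)-1$.
   Context: All graphs are finite, simple and connected; $n(G)=|V(G)|$ and $\Delta(G)$ is the maximum degree of $G$. For vertices $u,v$, $d_G(u,v)$ is the shortest-path distance; for an edge $x=ww'$ and a vertex $v$, $d_G(x,v)=\min\{d_G(w,v),d_G(w',v)\}$. A vertex $v$ resolves two elements $x,y\in V(G)\cup E(G)$ if $d_G(x,v)\ne d_G(y,v)$. A set $W\subseteq V(G)$ is a mixed resolving set of $G$ if every two distinct elements of $V(G)\cup E(G)$ are resolved by some vertex of $W$. The mixed metric dimension ${\rm mdim}(G)$ is the minimum cardinality of a mixed resolving set of $G$. (Graphs with $\Delta(G)\le 4$ are called chemical graphs.) -}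

module Defs where

open import Data.Nat using (ℕ; zero; suc; _≤_; _⊓_)
open import Data.Fin using (Fin; _<_)
open import Data.Fin.Subset using (Subset; _∈_; ∣_∣)
open import Data.Vec using (tabulate)
open import Data.Bool using (Bool; true; false)
open import Data.Product using (Σ; _×_; _,_; ∃; ∃-syntax)
open import Data.Sum using (_⊎_; inj₁; inj₂)
open import Relation.Binary.PropositionalEquality using (_≡_; _≢_)

record Graph (n : ℕ) : Set where
  field
    adj     : Fin n → Fin n → Bool
    symm    : ∀ u v → adj u v ≡ adj v u
    irrefl  : ∀ v → adj v v ≡ false

module _ {n : ℕ} (G : Graph n) where
  open Graph G

  data Walk : Fin n → Fin n → ℕ → Set where
    here : ∀ {u} → Walk u u zero
    step : ∀ {u w v k} → adj u w ≡ true → Walk w v k → Walk u v (suc k)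

  Connected : Set
  Connected = ∀ u v → ∃[ k ] Walk u v k

  degree : Fin n → ℕ
  degree v = ∣ tabulate (adj v) ∣

  MaxDegree≤ : ℕ → Set
  MaxDegree≤ d = ∀ v → degree v ≤ d

  Dist : Fin n → Fin n → ℕ → Set
  Dist u v k = Walk u v k × (∀ {m} → Walk u v m → k ≤ m)

  -- edges, each represented once as an ordered pair a < b
  Edge : Set
  Edge = Σ (Fin n × Fin n) λ { (a , b) → (a < b) × (adj a b ≡ true) }

  Elem : Set
  Elem = Fin n ⊎ Edge

  ElemDist : Elem → Fin n → ℕ → Set
  ElemDist (inj₁ u) v k = Dist u v k
  ElemDist (inj₂ ((a , b) , _)) v k =
    ∃[ ka ] ∃[ kb ] (Dist a v ka × Dist b v kb × k ≡ ka ⊓ kb)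

  Resolves : Fin n → Elem → Elem → Set
  Resolves v x y = ∀ {k l} → ElemDist x v k → ElemDist y v l → k ≢ l

  MixedResolving : Subset n → Set
  MixedResolving W = ∀ (x y : Elem) → x ≢ y → ∃[ v ] (v ∈ W × Resolves v x y)

  MDim≤ : ℕ → Set
  MDim≤ m = ∃[ W ] (MixedResolving W × ∣ W ∣ ≤ m)

-- A vertex v has a maximal neighbour s if v ∼ s and N[v] ⊆ N[s]. If some
-- vertex v has no maximal neighbour, then V(G) ∖ {v} is already a mixed
-- resolving set: every pair of elements is separated by a vertex other than v
-- lying on exactly one of them, except a vertex u together with the edge uv,
-- which is separated by a vertex of N[v] ∖ N[u]. It therefore suffices to show
-- that when Δ(G) ≤ 4 and every vertex has a maximal neighbour, n(G) ≤ 6.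
-- Take v of maximum degree and a maximal neighbour a of v; then N[a] = N[v].
-- Either N[v] is all of G (so n ≤ 5), or an edge xy leaves N[v]. A maximal
-- neighbour z of x then has exactly the neighbours v, a, x, y, and one checks
-- that {y, v, a, x, z, w} is closed under adjacency, where w is the fourth
-- neighbour of v if there is one; by connectivity this is the whole graph.
module Submission where

open import Defs
open import Level using (0ℓ)
open import Data.Nat using (ℕ; suc; _≤_; _<_; _∸_; z≤n; s≤s; _≤?_)
open import Data.Nat.Properties
  using (≤-refl; ≤-trans; <-irrefl; n≤1+n; m≤n⇒m≤1+n; ≰⇒>; <⇒≱; ∸-monoˡ-≤; m⊓n≤m; m⊓n≤n; ⊓-glb)
open import Data.Nat.Properties using (module ≤-Reasoning)
open import Data.Fin using (Fin; zero; suc; _≟_; fromℕ<)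
import Data.Fin.Properties as Fin
open import Data.Fin.Subset using (Subset; inside; outside; _∈_; _∉_; _-_; ⊤; ∣_∣)
open import Data.Fin.Subset.Properties
  using (p─⊥≡p; x∈p⇒∣p-x∣<∣p∣; x∈p∧x≢y⇒x∈p-y; p─q⊆p; p⊆q⇒∣p∣≤∣q∣; ∈⊤; ∣⊤∣≡n)
open import Data.Vec using (_∷_; there; tabulate)
open import Data.Vec.Properties using (lookup∘tabulate; []=⇒lookup; lookup⇒[]=)
open import Data.Bool using (true)
import Data.Bool.Properties as Bool
open import Data.List using (List; []; _∷_; length; allFin)
import Data.List as List
open import Data.List.Membership.Propositional using () renaming (_∈_ to _∈ˡ_)
open import Data.List.Membership.Propositional.Properties using (∈-++⁺ˡ; ∈-allFin)
open import Data.List.Relation.Unary.All as All using (All; []; _∷_)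
open import Data.List.Relation.Unary.All.Properties using (¬Any⇒All¬)
open import Data.List.Relation.Unary.AllPairs using ([]; _∷_)
open import Data.List.Relation.Unary.Any using (here; there; index; any?)
open import Data.List.Relation.Unary.Any.Properties using (lookup-index)
open import Data.List.Relation.Unary.Unique.Propositional using (Unique)
open import Data.List.Extrema.Nat using (argmax; f[xs]≤f[argmax])
open import Data.Product using (_×_; _,_; proj₁; proj₂; ∃; ∃-syntax)
open import Data.Sum using (_⊎_; inj₁; inj₂)
open import Data.Empty using (⊥-elim)
open import Function using (_∘_; id)
open import Relation.Binary.PropositionalEquality using (_≡_; _≢_; refl; sym; trans; cong; cong₂; subst)
open import Relation.Nullary using (¬_; Dec; yes; no; contradiction)
open import Relation.Nullary.Decidable using (_×-dec_; _⊎-dec_; _→-dec_; ¬?; decidable-stable)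
open import Relation.Unary using (Pred; Decidable; _⊆_)
open import Axiom.UniquenessOfIdentityProofs using (module Decidable⇒UIP)

∣s∷p∣≤1+∣p∣ : ∀ {n} s (p : Subset n) → ∣ s ∷ p ∣ ≤ suc ∣ p ∣
∣s∷p∣≤1+∣p∣ inside  p = ≤-refl
∣s∷p∣≤1+∣p∣ outside p = n≤1+n ∣ p ∣

∣p∣≤1+∣p-x∣ : ∀ {n} (p : Subset n) x → ∣ p ∣ ≤ suc ∣ p - x ∣
∣p∣≤1+∣p-x∣ (s ∷ p)       zero    =
  subst (λ q → ∣ s ∷ p ∣ ≤ suc ∣ q ∣) (sym (p─⊥≡p p)) (∣s∷p∣≤1+∣p∣ s p)
∣p∣≤1+∣p-x∣ (outside ∷ p) (suc x) = ∣p∣≤1+∣p-x∣ p x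
∣p∣≤1+∣p-x∣ (inside  ∷ p) (suc x) = s≤s (∣p∣≤1+∣p-x∣ p x)

x∉p-x : ∀ {n} (x : Fin n) (p : Subset n) → x ∉ p - x
x∉p-x zero    (s ∷ p) ()
x∉p-x (suc x) (s ∷ p) (there x∈p-x) = x∉p-x x p x∈p-x

∣⊤-x∣≤n∸1 : ∀ {n} (x : Fin n) → ∣ ⊤ - x ∣ ≤ n ∸ 1
∣⊤-x∣≤n∸1 {n} x =
  ∸-monoˡ-≤ 1 (subst (suc ∣ ⊤ - x ∣ ≤_) (∣⊤∣≡n n) (x∈p⇒∣p-x∣<∣p∣ {n} {x} {⊤} ∈⊤))

unique-⊆⇒length≤∣p∣ : ∀ {n} {p : Subset n} {xs : List (Fin n)} →
                      Unique xs → All (_∈ p) xs → length xs ≤ ∣ p ∣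
unique-⊆⇒length≤∣p∣ [] [] = z≤n
unique-⊆⇒length≤∣p∣ {p = p} {x ∷ xs} (x∉xs ∷ !xs) (x∈p ∷ xs⊆p) =
  ≤-trans (s≤s (unique-⊆⇒length≤∣p∣ !xs xs⊆p-x)) (x∈p⇒∣p-x∣<∣p∣ x∈p)
  where
  xs⊆p-x : All (_∈ p - x) xs
  xs⊆p-x = All.zipWith (λ (x≢y , y∈p) → x∈p∧x≢y⇒x∈p-y y∈p (x≢y ∘ sym)) (x∉xs , xs⊆p)

covering⇒n≤length : ∀ {n} (xs : List (Fin n)) → (∀ i → i ∈ˡ xs) → n ≤ length xs
covering⇒n≤length {n} xs cover with n ≤? length xs
... | yes n≤len = n≤len
... | no  n≰len with Fin.pigeonhole (≰⇒> n≰len) (index ∘ cover)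
...   | i , j , i<j , same-index = contradiction i≡j (Fin.<⇒≢ i<j)
  where
  i≡j : i ≡ j
  i≡j = trans (lookup-index (cover i)) (trans (cong (List.lookup xs) same-index) (sym (lookup-index (cover j))))

∈∧∉⇒≢ : ∀ {a} {A : Set a} {P : Pred A 0ℓ} {s t} → P s → ¬ P t → s ≢ t
∈∧∉⇒≢ ps ¬pt refl = ¬pt ps

module _ {n : ℕ} (G : Graph n) where
  open Graph G

  infix 4 _∼_
  _∼_ : Fin n → Fin n → Set
  u ∼ w = adj u w ≡ true

  _∼?_ : ∀ u w → Dec (u ∼ w)
  u ∼? w = adj u w Bool.≟ true

  ∼-sym : ∀ {u w} → u ∼ w → w ∼ u
  ∼-sym {u} {w} u∼w = trans (symm w u) u∼w

  ∼⇒≢ : ∀ {u w} → u ∼ w → u ≢ w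
  ∼⇒≢ {u} u∼u refl = contradiction (trans (sym u∼u) (irrefl u)) λ ()

  N[_] : Fin n → Pred (Fin n) 0ℓ
  N[ u ] t = t ≡ u ⊎ u ∼ t

  N[_]? : ∀ u → Decidable N[ u ]
  N[ u ]? t = (t ≟ u) ⊎-dec (u ∼? t)

  N[]-sym : ∀ {u t} → N[ u ] t → N[ t ] u
  N[]-sym (inj₁ refl) = inj₁ refl
  N[]-sym (inj₂ u∼t)  = inj₂ (∼-sym u∼t)

  N[]-≢⇒∼ : ∀ {u t} → N[ u ] t → t ≢ u → u ∼ t
  N[]-≢⇒∼ (inj₁ t≡u) t≢u = contradiction t≡u t≢u
  N[]-≢⇒∼ (inj₂ u∼t) _   = u∼t

  walk-≢⇒1≤ : ∀ {u w k} → u ≢ w → Walk G u w k → 1 ≤ k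
  walk-≢⇒1≤ u≢u here       = contradiction refl u≢u
  walk-≢⇒1≤ _   (step _ _) = s≤s z≤n

  walk-∉N[]⇒2≤ : ∀ {u w k} → ¬ N[ u ] w → Walk G u w k → 2 ≤ k
  walk-∉N[]⇒2≤ w∉N[u] here                = contradiction (inj₁ refl) w∉N[u]
  walk-∉N[]⇒2≤ w∉N[u] (step u∼w here)     = contradiction (inj₂ u∼w) w∉N[u]
  walk-∉N[]⇒2≤ _      (step _ (step _ _)) = s≤s (s≤s z≤n)

  dist-refl : ∀ {u} → Dist G u u 0
  dist-refl = here , λ _ → z≤n

  dist-∼ : ∀ {u w} → u ∼ w → Dist G u w 1
  dist-∼ u∼w = step u∼w here , walk-≢⇒1≤ (∼⇒≢ u∼w)

  _∈ᵛ_ : Fin n → Elem G → Set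
  w ∈ᵛ inj₁ u             = w ≡ u
  w ∈ᵛ inj₂ ((a , b) , _) = w ≡ a ⊎ w ≡ b

  _∈ᵛ?_ : ∀ w x → Dec (w ∈ᵛ x)
  w ∈ᵛ? inj₁ u             = w ≟ u
  w ∈ᵛ? inj₂ ((a , b) , _) = (w ≟ a) ⊎-dec (w ≟ b)

  ElemDist-≤ : ∀ {x t w j k} → t ∈ᵛ x → Dist G t w j → ElemDist G x w k → k ≤ j
  ElemDist-≤ {inj₁ _} refl        dt du                         = proj₂ du (proj₁ dt)
  ElemDist-≤ {inj₂ _} (inj₁ refl) dt (ka , kb , da , db , refl) = ≤-trans (m⊓n≤m ka kb) (proj₂ da (proj₁ dt))
  ElemDist-≤ {inj₂ _} (inj₂ refl) dt (ka , kb , da , db , refl) = ≤-trans (m⊓n≤n ka kb) (proj₂ db (proj₁ dt))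

  ElemDist-∉ᵛ⇒1≤ : ∀ {x w k} → ¬ w ∈ᵛ x → ElemDist G x w k → 1 ≤ k
  ElemDist-∉ᵛ⇒1≤ {inj₁ _} w∉x du = walk-≢⇒1≤ (w∉x ∘ sym) (proj₁ du)
  ElemDist-∉ᵛ⇒1≤ {inj₂ _} w∉x (ka , kb , da , db , refl) =
    ⊓-glb (walk-≢⇒1≤ (w∉x ∘ inj₁ ∘ sym) (proj₁ da)) (walk-≢⇒1≤ (w∉x ∘ inj₂ ∘ sym) (proj₁ db))

  Resolves-sym : ∀ {w x y} → Resolves G w x y → Resolves G w y x
  Resolves-sym resolves dy dx = resolves dx dy ∘ sym

  resolves-by-< : ∀ {w x y j} → (∀ {k} → ElemDist G x w k → k ≤ j) →
                  (∀ {l} → ElemDist G y w l → suc j ≤ l) → Resolves G w x y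
  resolves-by-< x≤j y>j dx dy refl = <-irrefl refl (≤-trans (s≤s (x≤j dx)) (y>j dy))

  ∈ᵛ-∉ᵛ⇒Resolves : ∀ {w x y} → w ∈ᵛ x → ¬ w ∈ᵛ y → Resolves G w x y
  ∈ᵛ-∉ᵛ⇒Resolves w∈x w∉y = resolves-by-< (ElemDist-≤ w∈x dist-refl) (ElemDist-∉ᵛ⇒1≤ w∉y)

  other-endpoint : ∀ {u} (e : Edge G) → u ∈ᵛ inj₂ e → ∃[ b ] (b ∈ᵛ inj₂ e × u ∼ b)
  other-endpoint ((a , b) , _ , a∼b) (inj₁ refl) = b , inj₂ refl , a∼b
  other-endpoint ((a , b) , _ , a∼b) (inj₂ refl) = a , inj₁ refl , ∼-sym a∼b

  edge-≡ : ∀ (e f : Edge G) → (∀ {w} → w ∈ᵛ inj₂ e → w ∈ᵛ inj₂ f) → e ≡ f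
  edge-≡ ((a , b) , a<b , a∼b) ((c , d) , c<d , c∼d) e⊆f with e⊆f (inj₁ refl) | e⊆f (inj₂ refl)
  ... | inj₁ refl | inj₂ refl =
    cong ((a , b) ,_) (cong₂ _,_ (Fin.<-irrelevant a<b c<d) (Decidable⇒UIP.≡-irrelevant Bool._≟_ a∼b c∼d))
  ... | inj₁ refl | inj₁ refl = contradiction a<b (Fin.<-irrefl refl)
  ... | inj₂ refl | inj₂ refl = contradiction a<b (Fin.<-irrefl refl)
  ... | inj₂ refl | inj₁ refl = contradiction c<d (Fin.<-asym a<b)

  edge-private-vertex : ∀ (e f : Edge G) → e ≢ f → ∃[ w ] (w ∈ᵛ inj₂ e × ¬ w ∈ᵛ inj₂ f)
  edge-private-vertex e f e≢f with Fin.any? (λ w → (w ∈ᵛ? inj₂ e) ×-dec ¬? (w ∈ᵛ? inj₂ f))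
  ... | yes private-vertex = private-vertex
  ... | no  none           = contradiction (edge-≡ e f e⊆f) e≢f
    where
    e⊆f : ∀ {w} → w ∈ᵛ inj₂ e → w ∈ᵛ inj₂ f
    e⊆f {w} w∈e = decidable-stable (w ∈ᵛ? inj₂ f) (λ w∉f → none (w , w∈e , w∉f))

  MaximalNeighbour : Fin n → Fin n → Set
  MaximalNeighbour u s = u ∼ s × N[ u ] ⊆ N[ s ]

  NoMaximalNeighbour : Fin n → Set
  NoMaximalNeighbour u = ∀ s → u ∼ s → ∃[ w ] (N[ u ] w × ¬ N[ s ] w)

  maximal-neighbour-dichotomy : ∀ u → NoMaximalNeighbour u ⊎ ∃ (MaximalNeighbour u)
  maximal-neighbour-dichotomy u with Fin.any? (λ s → (u ∼? s) ×-dec Fin.all? (λ t → N[ u ]? t →-dec N[ s ]? t))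
  ... | yes (s , u∼s , N[u]⊆N[s]) = inj₂ (s , u∼s , λ {t} → N[u]⊆N[s] t)
  ... | no  none                   = inj₁ escape
    where
    escape : NoMaximalNeighbour u
    escape s u∼s with Fin.any? (λ w → N[ u ]? w ×-dec ¬? (N[ s ]? w))
    ... | yes found = found
    ... | no  none′ = ⊥-elim (none (s , u∼s , N[u]⊆N[s]))
      where
      N[u]⊆N[s] : ∀ t → N[ u ] t → N[ s ] t
      N[u]⊆N[s] t t∈N[u] = decidable-stable (N[ s ]? t) (λ t∉N[s] → none′ (t , t∈N[u] , t∉N[s]))

  noMaximalNeighbour? : Decidable NoMaximalNeighbour
  noMaximalNeighbour? u with maximal-neighbour-dichotomy u
  ... | inj₁ none                      = yes none
  ... | inj₂ (s , u∼s , N[u]⊆N[s]) = no λ none →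
    let (w , w∈N[u] , w∉N[s]) = none s u∼s in w∉N[s] (N[u]⊆N[s] w∈N[u])

  module NoMaximalNeighbourResolving (v : Fin n) (no-max : NoMaximalNeighbour v) where

    Resolved : Elem G → Elem G → Set
    Resolved x y = ∃[ w ] (w ∈ ⊤ - v × Resolves G w x y)

    Resolved-sym : ∀ x y → Resolved x y → Resolved y x
    Resolved-sym x y (w , w∈W , resolves) = w , w∈W , Resolves-sym {w} {x} {y} resolves

    separated : ∀ {w} x y → w ≢ v → w ∈ᵛ x → ¬ w ∈ᵛ y → Resolved x y
    separated x y w≢v w∈x w∉y = _ , x∈p∧x≢y⇒x∈p-y ∈⊤ w≢v , ∈ᵛ-∉ᵛ⇒Resolves {x = x} {y} w∈x w∉y

    separated′ : ∀ {w} x y → w ≢ v → ¬ w ∈ᵛ x → w ∈ᵛ y → Resolved x y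
    separated′ x y w≢v w∉x w∈y = Resolved-sym y x (separated y x w≢v w∈y w∉x)

    vertices-resolved : ∀ u u′ → u ≢ u′ → Resolved (inj₁ u) (inj₁ u′)
    vertices-resolved u u′ u≢u′ with u ≟ v
    ... | no  u≢v  = separated (inj₁ u) (inj₁ u′) u≢v refl u≢u′
    ... | yes refl = separated′ (inj₁ u) (inj₁ u′) (u≢u′ ∘ sym) (u≢u′ ∘ sym) refl

    -- d(w, u) ≥ 2 while d(w, uv) ≤ d(w, v) = 1, for w ∈ N[v] ∖ N[u].
    endpoint-resolved : ∀ u e → u ∼ v → v ∈ᵛ inj₂ e → Resolved (inj₁ u) (inj₂ e)
    endpoint-resolved u e u∼v v∈e with no-max u (∼-sym u∼v)
    ... | w , w∈N[v] , w∉N[u] =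
      w , x∈p∧x≢y⇒x∈p-y ∈⊤ w≢v ,
      Resolves-sym {w} {inj₂ e} {inj₁ u}
        (resolves-by-< {x = inj₂ e} {inj₁ u}
          (ElemDist-≤ {inj₂ e} v∈e (dist-∼ v∼w)) (walk-∉N[]⇒2≤ w∉N[u] ∘ proj₁))
      where
      w≢v : w ≢ v
      w≢v refl = w∉N[u] (inj₂ u∼v)
      v∼w : v ∼ w
      v∼w = N[]-≢⇒∼ w∈N[v] w≢v

    vertex-edge-resolved : ∀ u e → Resolved (inj₁ u) (inj₂ e)
    vertex-edge-resolved u e with u ∈ᵛ? inj₂ e
    vertex-edge-resolved u e | yes u∈e with other-endpoint e u∈e
    ... | b , b∈e , u∼b with b ≟ v
    ...   | no  b≢v  = separated′ (inj₁ u) (inj₂ e) b≢v (∼⇒≢ u∼b ∘ sym) b∈e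
    ...   | yes refl = endpoint-resolved u e u∼b b∈e
    vertex-edge-resolved u e@((a , _) , _) | no u∉e with u ≟ v
    ... | no  u≢v  = separated (inj₁ u) (inj₂ e) u≢v refl u∉e
    ... | yes refl = separated′ (inj₁ v) (inj₂ e) a≢v a≢v (inj₁ refl)
      where
      a≢v : a ≢ v
      a≢v refl = u∉e (inj₁ refl)

    edges-resolved : ∀ e f → e ≢ f → Resolved (inj₂ e) (inj₂ f)
    edges-resolved e f e≢f with edge-private-vertex e f e≢f | edge-private-vertex f e (e≢f ∘ sym)
    ... | w , w∈e , w∉f | w′ , w′∈f , w′∉e with w ≟ v
    ...   | no  w≢v  = separated (inj₂ e) (inj₂ f) w≢v w∈e w∉f
    ...   | yes refl = separated′ (inj₂ e) (inj₂ f) (λ { refl → w′∉e w∈e }) w′∉e w′∈f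

    mixed-resolving : MixedResolving G (⊤ - v)
    mixed-resolving (inj₁ u) (inj₁ u′) x≢y = vertices-resolved u u′ (x≢y ∘ cong inj₁)
    mixed-resolving (inj₁ u) (inj₂ e)  _   = vertex-edge-resolved u e
    mixed-resolving (inj₂ e) (inj₁ u)  _   = Resolved-sym (inj₁ u) (inj₂ e) (vertex-edge-resolved u e)
    mixed-resolving (inj₂ e) (inj₂ f)  x≢y = edges-resolved e f (x≢y ∘ cong inj₂)

  open NoMaximalNeighbourResolving using (mixed-resolving) public

  neighbourhood : Fin n → Subset n
  neighbourhood u = tabulate (adj u)

  ∼⇒∈neighbourhood : ∀ {u t} → u ∼ t → t ∈ neighbourhood u
  ∼⇒∈neighbourhood {u} {t} u∼t = lookup⇒[]= t (neighbourhood u) (trans (lookup∘tabulate (adj u) t) u∼t)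

  ∈neighbourhood⇒∼ : ∀ {u t} → t ∈ neighbourhood u → u ∼ t
  ∈neighbourhood⇒∼ {u} {t} t∈N = trans (sym (lookup∘tabulate (adj u) t)) ([]=⇒lookup t∈N)

  maximal-neighbour-degree-< : ∀ {u s t} → MaximalNeighbour u s → s ∼ t → ¬ N[ u ] t →
                               degree G u < degree G s
  maximal-neighbour-degree-< {u} {s} {t} (u∼s , N[u]⊆N[s]) s∼t t∉N[u] = begin-strict
    ∣ neighbourhood u ∣               ≤⟨ ∣p∣≤1+∣p-x∣ (neighbourhood u) s ⟩
    suc ∣ neighbourhood u - s ∣       ≤⟨ s≤s (p⊆q⇒∣p∣≤∣q∣ shift) ⟩
    suc ∣ neighbourhood s - u - t ∣   <⟨ s≤s (x∈p⇒∣p-x∣<∣p∣ (x∈p∧x≢y⇒x∈p-y (∼⇒∈neighbourhood s∼t) t≢u)) ⟩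
    suc ∣ neighbourhood s - u ∣       ≤⟨ x∈p⇒∣p-x∣<∣p∣ (∼⇒∈neighbourhood (∼-sym u∼s)) ⟩
    ∣ neighbourhood s ∣               ∎
    where
    open ≤-Reasoning
    t≢u : t ≢ u
    t≢u t≡u = t∉N[u] (inj₁ t≡u)
    shift : ∀ {r} → r ∈ neighbourhood u - s → r ∈ neighbourhood s - u - t
    shift {r} r∈N[u]-s = move (N[u]⊆N[s] (inj₂ u∼r))
      where
      u∼r : u ∼ r
      u∼r = ∈neighbourhood⇒∼ (p─q⊆p _ _ r∈N[u]-s)
      move : N[ s ] r → r ∈ neighbourhood s - u - t
      move (inj₁ refl) = contradiction r∈N[u]-s (x∉p-x s _)
      move (inj₂ s∼r)  = x∈p∧x≢y⇒x∈p-y (x∈p∧x≢y⇒x∈p-y (∼⇒∈neighbourhood s∼r) (∼⇒≢ u∼r ∘ sym))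
                                        (λ { refl → t∉N[u] (inj₂ u∼r) })

  maximal-neighbour-flip : ∀ {u s} → MaximalNeighbour u s → degree G s ≤ degree G u → N[ s ] ⊆ N[ u ]
  maximal-neighbour-flip {u} max deg-s≤deg-u {t} t∈N[s] with N[ u ]? t
  ... | yes t∈N[u] = t∈N[u]
  ... | no  t∉N[u] with t∈N[s]
  ...   | inj₁ refl = contradiction (inj₂ (proj₁ max)) t∉N[u]
  ...   | inj₂ s∼t  = contradiction deg-s≤deg-u (<⇒≱ (maximal-neighbour-degree-< max s∼t t∉N[u]))

  N[]-universal⇒n≤1+degree : ∀ {u} → (∀ t → N[ u ] t) → n ≤ suc (degree G u)
  N[]-universal⇒n≤1+degree {u} universal = begin
    n                      ≡⟨ sym (∣⊤∣≡n n) ⟩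
    ∣ ⊤ {n} ∣              ≤⟨ ∣p∣≤1+∣p-x∣ ⊤ u ⟩
    suc ∣ ⊤ - u ∣          ≤⟨ s≤s (p⊆q⇒∣p∣≤∣q∣ ⊤-u⊆N) ⟩
    suc ∣ neighbourhood u ∣ ∎
    where
    open ≤-Reasoning
    ⊤-u⊆N : ∀ {t} → t ∈ ⊤ - u → t ∈ neighbourhood u
    ⊤-u⊆N {t} t∈⊤-u with universal t
    ... | inj₁ refl = contradiction t∈⊤-u (x∉p-x u ⊤)
    ... | inj₂ u∼t  = ∼⇒∈neighbourhood u∼t

  unique-neighbours⇒length≤degree : ∀ {u xs} → Unique xs → All (u ∼_) xs → length xs ≤ degree G u
  unique-neighbours⇒length≤degree !xs u∼xs = unique-⊆⇒length≤∣p∣ !xs (All.map ∼⇒∈neighbourhood u∼xs)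

  neighbours-exhausted : ∀ {u t xs} → MaxDegree≤ G (length xs) → Unique xs → All (u ∼_) xs → u ∼ t → t ∈ˡ xs
  neighbours-exhausted {u} {t} {xs} Δ≤ !xs u∼xs u∼t with any? (t ≟_) xs
  ... | yes t∈xs = t∈xs
  ... | no  t∉xs = contradiction (≤-trans too-many (Δ≤ u)) (<-irrefl refl)
    where
    too-many : suc (length xs) ≤ degree G u
    too-many = unique-neighbours⇒length≤degree (¬Any⇒All¬ xs t∉xs ∷ !xs) (u∼t ∷ u∼xs)

  max-degree-vertex : Fin n → ∃[ v ] (∀ u → degree G u ≤ degree G v)
  max-degree-vertex v₀ =
    argmax (degree G) v₀ (allFin n) , λ u → All.lookup (f[xs]≤f[argmax] v₀ (allFin n)) (∈-allFin u)

  Closed : Pred (Fin n) 0ℓ → Set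
  Closed P = ∀ {u t} → P u → u ∼ t → P t

  exit-or-closed : ∀ {P} → Decidable P → (∃[ x ] ∃[ y ] (P x × x ∼ y × ¬ P y)) ⊎ Closed P
  exit-or-closed P? with Fin.any? (λ x → Fin.any? (λ y → P? x ×-dec ((x ∼? y) ×-dec ¬? (P? y))))
  ... | yes exit = inj₁ exit
  ... | no  none = inj₂ λ {x} {y} px x∼y → decidable-stable (P? y) (λ ¬py → none (x , y , px , x∼y , ¬py))

  closed⇒universal : ∀ {P u} → Connected G → Closed P → P u → ∀ t → P t
  closed⇒universal {P} {u} conn closed pu t = along (proj₂ (conn u t)) pu
    where
    along : ∀ {u′ k} → Walk G u′ t k → P u′ → P t
    along here          p = p
    along (step u∼w wk) p = along wk (closed p u∼w)

  closed-list⇒n≤length : ∀ {u xs} → Connected G → Closed (_∈ˡ xs) → u ∈ˡ xs → n ≤ length xs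
  closed-list⇒n≤length {xs = xs} conn closed u∈xs = covering⇒n≤length xs (closed⇒universal conn closed u∈xs)

  module AllMaximalNeighbours (conn : Connected G) (Δ≤4 : MaxDegree≤ G 4)
                              (m : ∀ u → ∃ (MaximalNeighbour u)) (v₀ : Fin n) where

    v : Fin n
    v = proj₁ (max-degree-vertex v₀)

    a : Fin n
    a = proj₁ (m v)

    v∼a : v ∼ a
    v∼a = proj₁ (proj₂ (m v))

    N[v]⊆N[a] : N[ v ] ⊆ N[ a ]
    N[v]⊆N[a] = proj₂ (proj₂ (m v))

    N[a]⊆N[v] : N[ a ] ⊆ N[ v ]
    N[a]⊆N[v] = maximal-neighbour-flip (proj₂ (m v)) (proj₂ (max-degree-vertex v₀) a)

    closed-n≤6 : Closed N[ v ] → n ≤ 6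
    closed-n≤6 closed = m≤n⇒m≤1+n (≤-trans n≤1+deg (s≤s (Δ≤4 v)))
      where
      n≤1+deg : n ≤ suc (degree G v)
      n≤1+deg = N[]-universal⇒n≤1+degree (closed⇒universal conn closed (inj₁ refl))

    module Exit {x y} (x∈N[v] : N[ v ] x) (x∼y : x ∼ y) (y∉N[v] : ¬ N[ v ] y) where

      y∉N[a] : ¬ N[ a ] y
      y∉N[a] = y∉N[v] ∘ N[a]⊆N[v]

      x≢v : x ≢ v
      x≢v = ∈∧∉⇒≢ {P = λ q → N[ q ] y} (inj₂ x∼y) y∉N[v]

      x≢a : x ≢ a
      x≢a = ∈∧∉⇒≢ {P = λ q → N[ q ] y} (inj₂ x∼y) y∉N[a]

      z : Fin n
      z = proj₁ (m x)

      x∼z : x ∼ z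
      x∼z = proj₁ (proj₂ (m x))

      N[x]⊆N[z] : N[ x ] ⊆ N[ z ]
      N[x]⊆N[z] = proj₂ (proj₂ (m x))

      y∈N[z] : N[ z ] y
      y∈N[z] = N[x]⊆N[z] (inj₂ x∼y)

      v∼x : v ∼ x
      v∼x = N[]-≢⇒∼ x∈N[v] x≢v

      y≢v : y ≢ v
      y≢v = ∈∧∉⇒≢ {P = N[ v ]} (inj₁ refl) y∉N[v] ∘ sym

      y≢a : y ≢ a
      y≢a = ∈∧∉⇒≢ {P = N[ a ]} (inj₁ refl) y∉N[a] ∘ sym

      a∼x : a ∼ x
      a∼x = N[]-≢⇒∼ (N[v]⊆N[a] x∈N[v]) x≢a

      z∼v : z ∼ v
      z∼v = N[]-≢⇒∼ (N[x]⊆N[z] (inj₂ (∼-sym v∼x)))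
                    (∈∧∉⇒≢ {P = λ q → N[ q ] y} y∈N[z] y∉N[v] ∘ sym)

      z∼a : z ∼ a
      z∼a = N[]-≢⇒∼ (N[x]⊆N[z] (inj₂ (∼-sym a∼x)))
                    (∈∧∉⇒≢ {P = λ q → N[ q ] y} y∈N[z] y∉N[a] ∘ sym)

      z∼y : z ∼ y
      z∼y = N[]-≢⇒∼ y∈N[z] (∈∧∉⇒≢ {P = N[ v ]} (inj₂ (∼-sym z∼v)) y∉N[v] ∘ sym)

      z-neighbours : ∀ {t} → z ∼ t → t ∈ˡ y ∷ v ∷ a ∷ x ∷ []
      z-neighbours = neighbours-exhausted Δ≤4 distinct (z∼y ∷ z∼v ∷ z∼a ∷ ∼-sym x∼z ∷ [])
        where
        distinct : Unique (y ∷ v ∷ a ∷ x ∷ [])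
        distinct = (y≢v ∷ y≢a ∷ ∼⇒≢ x∼y ∘ sym ∷ [])
                 ∷ (∼⇒≢ v∼a ∷ x≢v ∘ sym ∷ []) ∷ (x≢a ∘ sym ∷ []) ∷ [] ∷ []

      -- A maximal neighbour s of y lies in N[z] and cannot be y, v or a; so s ∈ {x, z}.
      N[y]⊆N[z] : N[ y ] ⊆ N[ z ]
      N[y]⊆N[z] with m y
      ... | s , y∼s , N[y]⊆N[s] with N[]-sym (N[y]⊆N[s] (inj₂ (∼-sym z∼y)))
      ...   | inj₁ refl = N[y]⊆N[s]
      ...   | inj₂ z∼s with z-neighbours z∼s
      ...     | here refl                         = contradiction refl (∼⇒≢ y∼s)
      ...     | there (here refl)                 = contradiction (inj₂ (∼-sym y∼s)) y∉N[v]
      ...     | there (there (here refl))         = contradiction (inj₂ (∼-sym y∼s)) y∉N[a]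
      ...     | there (there (there (here refl))) = N[x]⊆N[z] ∘ N[y]⊆N[s]

      -- If v has no fourth neighbour besides a, x, z, then w = v serves.
      fourth-neighbour : ∃[ w ] ((∀ {t} → v ∼ t → t ∈ˡ a ∷ x ∷ z ∷ w ∷ []) × N[ w ] ⊆ N[ v ])
      fourth-neighbour with Fin.any? (λ w → (v ∼? w) ×-dec ¬? (any? (w ≟_) (a ∷ x ∷ z ∷ [])))
      ... | no  none = v , v-neighbours , id
        where
        v-neighbours : ∀ {t} → v ∼ t → t ∈ˡ a ∷ x ∷ z ∷ v ∷ []
        v-neighbours {t} v∼t = ∈-++⁺ˡ (decidable-stable (any? (t ≟_) _) (λ t∉axz → none (t , v∼t , t∉axz)))
      ... | yes (w , v∼w , w∉axz) = w , v-neighbours , N[w]⊆N[v]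
        where
        distinct : Unique (a ∷ x ∷ z ∷ w ∷ [])
        distinct = (x≢a ∘ sym ∷ ∼⇒≢ z∼a ∘ sym ∷ (λ { refl → w∉axz (here refl) }) ∷ [])
                 ∷ (∼⇒≢ x∼z ∷ (λ { refl → w∉axz (there (here refl)) }) ∷ [])
                 ∷ ((λ { refl → w∉axz (there (there (here refl))) }) ∷ []) ∷ [] ∷ []
        w∉N[z] : ¬ N[ z ] w
        w∉N[z] (inj₁ refl) = w∉axz (there (there (here refl)))
        w∉N[z] (inj₂ z∼w) = w∉yvax (z-neighbours z∼w)
          where
          w∉yvax : ¬ w ∈ˡ y ∷ v ∷ a ∷ x ∷ []
          w∉yvax (here refl)                         = y∉N[v] (inj₂ v∼w)
          w∉yvax (there (here refl))                 = ∼⇒≢ v∼w refl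
          w∉yvax (there (there (here refl)))         = w∉axz (here refl)
          w∉yvax (there (there (there (here refl)))) = w∉axz (there (here refl))
        v-neighbours : ∀ {t} → v ∼ t → t ∈ˡ a ∷ x ∷ z ∷ w ∷ []
        v-neighbours = neighbours-exhausted Δ≤4 distinct (v∼a ∷ v∼x ∷ ∼-sym z∼v ∷ v∼w ∷ [])
        N[w]⊆N[v] : N[ w ] ⊆ N[ v ]
        N[w]⊆N[v] with m w
        ... | s , w∼s , N[w]⊆N[s] with N[]-sym (N[w]⊆N[s] (inj₂ (∼-sym v∼w)))
        ...   | inj₁ refl = N[w]⊆N[s]
        ...   | inj₂ v∼s with v-neighbours v∼s
        ...     | here refl                         = N[a]⊆N[v] ∘ N[w]⊆N[s]
        ...     | there (here refl)                 = contradiction (N[x]⊆N[z] (inj₂ (∼-sym w∼s))) w∉N[z]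
        ...     | there (there (here refl))         = contradiction (inj₂ (∼-sym w∼s)) w∉N[z]
        ...     | there (there (there (here refl))) = contradiction refl (∼⇒≢ w∼s)

      n≤6 : n ≤ 6
      n≤6 with fourth-neighbour
      ... | w , v-neighbours , N[w]⊆N[v] = closed-list⇒n≤length conn closed (here refl)
        where
        N[v]⊆L : N[ v ] ⊆ (_∈ˡ y ∷ v ∷ a ∷ x ∷ z ∷ w ∷ [])
        N[v]⊆L (inj₁ refl) = there (here refl)
        N[v]⊆L (inj₂ v∼t)  = there (there (v-neighbours v∼t))
        N[z]⊆L : N[ z ] ⊆ (_∈ˡ y ∷ v ∷ a ∷ x ∷ z ∷ w ∷ [])
        N[z]⊆L (inj₁ refl) = there (there (there (there (here refl))))
        N[z]⊆L (inj₂ z∼t)  = ∈-++⁺ˡ (z-neighbours z∼t)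
        closed : Closed (_∈ˡ y ∷ v ∷ a ∷ x ∷ z ∷ w ∷ [])
        closed (here refl)                                         ∼t = N[z]⊆L (N[y]⊆N[z] (inj₂ ∼t))
        closed (there (here refl))                                 ∼t = N[v]⊆L (inj₂ ∼t)
        closed (there (there (here refl)))                         ∼t = N[v]⊆L (N[a]⊆N[v] (inj₂ ∼t))
        closed (there (there (there (here refl))))                 ∼t = N[z]⊆L (N[x]⊆N[z] (inj₂ ∼t))
        closed (there (there (there (there (here refl)))))         ∼t = N[z]⊆L (inj₂ ∼t)
        closed (there (there (there (there (there (here refl)))))) ∼t = N[v]⊆L (N[w]⊆N[v] (inj₂ ∼t))

    n≤6 : n ≤ 6
    n≤6 with exit-or-closed N[ v ]?
    ... | inj₁ (x , y , x∈N[v] , x∼y , y∉N[v]) = Exit.n≤6 x∈N[v] x∼y y∉N[v]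
    ... | inj₂ closed                           = closed-n≤6 closed

  vertex-without-maximal-neighbour : Connected G → MaxDegree≤ G 4 → 7 ≤ n → ∃ NoMaximalNeighbour
  vertex-without-maximal-neighbour conn Δ≤4 7≤n with Fin.any? noMaximalNeighbour?
  ... | yes found = found
  ... | no  none  = contradiction (AllMaximalNeighbours.n≤6 conn Δ≤4 maximal v₀) (<⇒≱ 7≤n)
    where
    maximal : ∀ u → ∃ (MaximalNeighbour u)
    maximal u with maximal-neighbour-dichotomy u
    ... | inj₁ no-max = contradiction (u , no-max) none
    ... | inj₂ max    = max
    v₀ : Fin n
    v₀ = fromℕ< {0} (≤-trans (s≤s z≤n) 7≤n)

mainTheorem2 : ∀ (n : ℕ) (G : Graph n) → Connected G → MaxDegree≤ G 4 → 7 ≤ n →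
    MDim≤ G (n ∸ 1)
mainTheorem2 n G conn Δ≤4 7≤n with vertex-without-maximal-neighbour G conn Δ≤4 7≤n
... | v , no-max = ⊤ - v , mixed-resolving G v no-max , ∣⊤-x∣≤n∸1 v
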